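{- (i) Let $r,t$ be positive integers and let $P$ be the disjoint sum of $t$ chains, each containing $r$ elements. If $k$ is the positive integer with $(k-1)_r<t\le (k)_r$, then $\chi_D(P)=k$. (ii) Let $P$ be a disjoint sum of chains, partitioned as $P_1+\cdots+P_m$, where $P_i$ consists of $t_i$ chains each with $r_i$ points and $r_1,\dots,r_m$ are distinct. Then $\chi_D(P)=\max\{\chi_D(P_i):1\le i\le m\}$.
   Context: $(k)_r=k(k-1)\cdots(k-r+1)$ denotes the falling factorial. For a finite poset $P$, a coloring is proper if comparable points get different colors, and distinguishing if the only color-preserving automorphism of $P$ is the identity; $\chi_D(P)$ is the least number of colors in a proper distinguishing coloring. In a sum of posets, points of different summands are incomparable. -}

module Defs where

open import Level using (0ℓ)
open import Data.Nat as ℕ using (ℕ; zero; suc; _*_; _∸_; _⊔_; _≤_)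
open import Data.Nat.Properties as ℕP using (≤-refl; ≤-antisym; ≤-trans)
open import Data.Fin as Fin using (Fin; toℕ)
open import Data.Fin.Properties using (toℕ-injective; +↔⊎; 0↔⊥)
open import Data.Empty using (⊥)
open import Data.Sum using (_⊎_; inj₁; inj₂)
open import Data.Product using (Σ; Σ-syntax; _×_; _,_)
open import Function using (_∘_)
open import Function.Bundles using (_↔_; _⇔_)
open import Function.Properties.Inverse using (↔-sym; ↔-trans)
open import Data.Sum.Function.Propositional using (_⊎-↔_)
open import Relation.Binary.PropositionalEquality using (_≡_; _≢_; refl; cong)

record FinPoset : Set₁ where
  field
    Carrier : Set
    _≼_     : Carrier → Carrier → Set
    ≼-refl    : ∀ {x} → x ≼ x
    ≼-antisym : ∀ {x y} → x ≼ y → y ≼ x → x ≡ y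
    ≼-trans   : ∀ {x y z} → x ≼ y → y ≼ z → x ≼ z
    size    : ℕ
    enum    : Carrier ↔ Fin size

open FinPoset public

Comparable : (P : FinPoset) → Carrier P → Carrier P → Set
Comparable P x y = _≼_ P x y ⊎ _≼_ P y x

record Automorphism (P : FinPoset) : Set where
  field
    fun   : Carrier P → Carrier P
    inv   : Carrier P → Carrier P
    fun-inv : ∀ x → fun (inv x) ≡ x
    inv-fun : ∀ x → inv (fun x) ≡ x
    order : ∀ x y → (_≼_ P x y ⇔ _≼_ P (fun x) (fun y))

open Automorphism public

Coloring : FinPoset → ℕ → Set
Coloring P k = Carrier P → Fin k

Proper : (P : FinPoset) {k : ℕ} → Coloring P k → Set
Proper P c = ∀ x y → Comparable P x y → x ≢ y → c x ≢ c y

Distinguishing : (P : FinPoset) {k : ℕ} → Coloring P k → Set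
Distinguishing P c =
  (f : Automorphism P) → (∀ x → c (fun f x) ≡ c x) → ∀ x → fun f x ≡ x

ProperDistinguishing : (P : FinPoset) (k : ℕ) → Set
ProperDistinguishing P k = Σ[ c ∈ Coloring P k ] (Proper P c × Distinguishing P c)

χD≡ : FinPoset → ℕ → Set
χD≡ P k = ProperDistinguishing P k × (∀ j → ProperDistinguishing P j → k ≤ j)

chain : ℕ → FinPoset
chain r = record
  { Carrier = Fin r
  ; _≼_ = λ a b → toℕ a ≤ toℕ b
  ; ≼-refl = ≤-refl
  ; ≼-antisym = λ p q → toℕ-injective (≤-antisym p q)
  ; ≼-trans = ≤-trans
  ; size = r
  ; enum = record { to = λ x → x ; from = λ x → x ; to-cong = λ e → e
                  ; from-cong = λ e → e ; inverse = (λ e → e) , (λ e → e) }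
  }

data SumLe (P Q : FinPoset) : Carrier P ⊎ Carrier Q → Carrier P ⊎ Carrier Q → Set where
  ₁≼₁ : ∀ {a b} → _≼_ P a b → SumLe P Q (inj₁ a) (inj₁ b)
  ₂≼₂ : ∀ {a b} → _≼_ Q a b → SumLe P Q (inj₂ a) (inj₂ b)

_⊕_ : FinPoset → FinPoset → FinPoset
P ⊕ Q = record
  { Carrier = Carrier P ⊎ Carrier Q
  ; _≼_ = SumLe P Q
  ; ≼-refl = rf
  ; ≼-antisym = as
  ; ≼-trans = tr
  ; size = size P ℕ.+ size Q
  ; enum = ↔-trans (enum P ⊎-↔ enum Q) (↔-sym +↔⊎)
  }
  where
  rf : ∀ {x} → SumLe P Q x x
  rf {inj₁ a} = ₁≼₁ (≼-refl P)
  rf {inj₂ a} = ₂≼₂ (≼-refl Q)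
  as : ∀ {x y} → SumLe P Q x y → SumLe P Q y x → x ≡ y
  as (₁≼₁ p) (₁≼₁ q) = cong inj₁ (≼-antisym P p q)
  as (₂≼₂ p) (₂≼₂ q) = cong inj₂ (≼-antisym Q p q)
  tr : ∀ {x y z} → SumLe P Q x y → SumLe P Q y z → SumLe P Q x z
  tr (₁≼₁ p) (₁≼₁ q) = ₁≼₁ (≼-trans P p q)
  tr (₂≼₂ p) (₂≼₂ q) = ₂≼₂ (≼-trans Q p q)

∅P : FinPoset
∅P = record
  { Carrier = ⊥ ; _≼_ = λ _ _ → ⊥
  ; ≼-refl = λ {x} → x ; ≼-antisym = λ () ; ≼-trans = λ ()
  ; size = 0 ; enum = ↔-sym 0↔⊥ }

⨁ : (m : ℕ) → (Fin m → FinPoset) → FinPoset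
⨁ zero    P = ∅P
⨁ (suc m) P = P Fin.zero ⊕ ⨁ m (P ∘ Fin.suc)

chains : (t r : ℕ) → FinPoset
chains t r = ⨁ t (λ _ → chain r)

fall : ℕ → ℕ → ℕ
fall k zero    = 1
fall k (suc r) = fall k r * (k ∸ r)

maxF : (m : ℕ) → (Fin m → ℕ) → ℕ
maxF zero    f = 0
maxF (suc m) f = f Fin.zero ⊔ maxF m (f ∘ Fin.suc)

module Submission where

-- Given a decomposition of a poset into disjoint chains, a colouring is
-- proper iff it is injective on every chain, and distinguishing iff no two
-- distinct chains of equal length carry the same colour sequence.  For the
-- latter, automorphisms preserve heights and chain lengths (a counting
-- argument on the points below x and below f x), and two chains with equal
-- colour sequences are swapped by a colour-preserving automorphism.
--
-- The falling factorial (k)_r counts the injections Fin r → Fin k (they are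
-- encoded into and decoded from Fin (k)_r).  Hence t chains of r points have
-- a proper distinguishing k-colouring iff t ≤ (k)_r, which is part (i).
-- Part (ii) holds because, when the summands have distinct chain lengths, a
-- proper distinguishing colouring of the sum is one of each summand.

open import Defs
open import Data.Nat using (ℕ; _≤_; _<_; _∸_)
open import Data.Fin using (Fin)
open import Data.Product using (_×_)
open import Function.Definitions using (Injective)
open import Relation.Binary.PropositionalEquality using (_≡_)

open import Data.Nat as ℕ using (zero; suc; _*_; z≤n)
import Data.Nat.Properties as ℕP
open import Data.Fin as Fin using (toℕ; fromℕ<; punchIn; punchOut; combine; remQuot; inject≤; cast)
import Data.Fin.Properties as FinP
open import Data.Product using (Σ-syntax; _,_; proj₁; proj₂)
open import Data.Sum using (_⊎_; inj₁; inj₂)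
import Data.Sum.Properties as SumP
open import Data.Unit using (⊤; tt)
open import Data.Empty using (⊥; ⊥-elim)
open import Relation.Nullary using (yes; no)
open import Relation.Binary.PropositionalEquality
  using (_≢_; refl; sym; trans; cong; cong₂; subst; subst₂; module ≡-Reasoning)
open import Relation.Binary.Definitions using (DecidableEquality)
open import Function using (_∘_)
open import Function.Bundles using (Equivalence; mk⇔; _↣_; _↔_; Injection; mk↔ₛ′)
open import Function.Properties.Inverse using (↔⇒↣; ↔-sym)

-- The recursion (k+1)_(r+1) = (k+1)·(k)_r, behind the choice "first value,
-- then an injection into the remaining k values".
fall-suc : ∀ k r → fall (suc k) (suc r) ≡ suc k * fall k r
fall-suc k zero    = ℕP.*-comm 1 (suc k)
fall-suc k (suc r) = begin
  fall (suc k) (suc r) * (k ∸ r) ≡⟨ cong (_* (k ∸ r)) (fall-suc k r) ⟩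
  suc k * fall k r * (k ∸ r)     ≡⟨ ℕP.*-assoc (suc k) (fall k r) (k ∸ r) ⟩
  suc k * fall k (suc r)         ∎
  where open ≡-Reasoning

-- There is no injection from a nonempty set into the empty one.
fall-zero : ∀ r → fall 0 (suc r) ≡ 0
fall-zero r = trans (cong (fall 0 r *_) (ℕP.0∸n≡0 r)) (ℕP.*-zeroʳ (fall 0 r))

fall-monoˡ : ∀ {a b} r → a ≤ b → fall a r ≤ fall b r
fall-monoˡ zero    a≤b = ℕP.≤-refl
fall-monoˡ (suc r) a≤b = ℕP.*-mono-≤ (fall-monoˡ r a≤b) (ℕP.∸-monoˡ-≤ r a≤b)

cast-injective : ∀ {m n} .(eq : m ≡ n) {a b : Fin m} → cast eq a ≡ cast eq b → a ≡ b
cast-injective eq {a} {b} e = begin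
  a                         ≡⟨ sym (FinP.cast-involutive (sym eq) eq a) ⟩
  cast (sym eq) (cast eq a) ≡⟨ cong (cast (sym eq)) e ⟩
  cast (sym eq) (cast eq b) ≡⟨ FinP.cast-involutive (sym eq) eq b ⟩
  b                         ∎
  where open ≡-Reasoning

-- An injection s : Fin (1+r) → Fin (1+k) splits into its head s 0 and the
-- injection Fin r → Fin k obtained by punching s 0 out of the later values.
module Split {k r : ℕ} (s : Fin (suc r) → Fin (suc k)) (s-inj : Injective _≡_ _≡_ s) where

  head≢ : ∀ a → s Fin.zero ≢ s (Fin.suc a)
  head≢ a e with s-inj e
  ... | ()

  tail : Fin r → Fin k
  tail a = punchOut (head≢ a)

  tail-injective : Injective _≡_ _≡_ tail
  tail-injective {a} {b} e =
    FinP.suc-injective (s-inj (FinP.punchOut-injective (head≢ a) (head≢ b) e))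

  s-suc : ∀ a → s (Fin.suc a) ≡ punchIn (s Fin.zero) (tail a)
  s-suc a = sym (FinP.punchIn-punchOut (head≢ a))

-- Encoding: distinct injections Fin r → Fin k get distinct codes in
-- Fin (k)_r, so there are at most (k)_r of them.
encode : ∀ k r (s : Fin r → Fin k) → Injective _≡_ _≡_ s → Fin (fall k r)
encode k       zero    s _ = Fin.zero
encode zero    (suc r) s _ with s Fin.zero
... | ()
encode (suc k) (suc r) s s-inj =
  cast (sym (fall-suc k r)) (combine (s Fin.zero) (encode k r tail tail-injective))
  where open Split s s-inj

encode-injective : ∀ k r (s s' : Fin r → Fin k)
                   (s-inj : Injective _≡_ _≡_ s) (s'-inj : Injective _≡_ _≡_ s') →
                   encode k r s s-inj ≡ encode k r s' s'-inj → ∀ a → s a ≡ s' a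
encode-injective k       zero    s s' _ _ _ ()
encode-injective zero    (suc r) s s' _ _ _ a with s a
... | ()
encode-injective (suc k) (suc r) s s' s-inj s'-inj e a
  with FinP.combine-injective (s Fin.zero) _ (s' Fin.zero) _ (cast-injective (sym (fall-suc k r)) e)
... | heads , tails = pointwise a
  where
  module S  = Split s s-inj
  module S' = Split s' s'-inj
  pointwise : ∀ a → s a ≡ s' a
  pointwise Fin.zero    = heads
  pointwise (Fin.suc a) = begin
    s (Fin.suc a)                     ≡⟨ S.s-suc a ⟩
    punchIn (s Fin.zero) (S.tail a)   ≡⟨ cong₂ punchIn heads
      (encode-injective k r S.tail S'.tail S.tail-injective S'.tail-injective tails a) ⟩
    punchIn (s' Fin.zero) (S'.tail a) ≡⟨ sym (S'.s-suc a) ⟩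
    s' (Fin.suc a)                    ∎
    where open ≡-Reasoning

-- A code in Fin (k+1)_(r+1) splits into the first value of an injection
-- and the code of the remaining injection Fin r → Fin k.
module _ (k r : ℕ) (c : Fin (fall (suc k) (suc r))) where
  private
    split : Fin (suc k) × Fin (fall k r)
    split = remQuot {suc k} (fall k r) (cast (fall-suc k r) c)

  head-code : Fin (suc k)
  head-code = proj₁ split

  tail-code : Fin (fall k r)
  tail-code = proj₂ split

  combine-code : combine head-code tail-code ≡ cast (fall-suc k r) c
  combine-code = FinP.combine-remQuot {suc k} (fall k r) _

-- Decoding: every code c : Fin (k)_r names an injection decode c, and
-- distinct codes name distinct injections, so there are (k)_r of them.
decode : ∀ k r → Fin (fall k r) → Fin r → Fin k
decode k       zero    c ()
decode zero    (suc r) c a = ⊥-elim (FinP.¬Fin0 (cast (fall-zero r) c))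
decode (suc k) (suc r) c Fin.zero    = head-code k r c
decode (suc k) (suc r) c (Fin.suc a) = punchIn (head-code k r c) (decode k r (tail-code k r c) a)

decode-injective : ∀ k r c → Injective _≡_ _≡_ (decode k r c)
decode-injective k       zero    c {()}
decode-injective zero    (suc r) c {a} = ⊥-elim (FinP.¬Fin0 (cast (fall-zero r) c))
decode-injective (suc k) (suc r) c {Fin.zero}  {Fin.zero}  e = refl
decode-injective (suc k) (suc r) c {Fin.zero}  {Fin.suc b} e = ⊥-elim (FinP.punchInᵢ≢i _ _ (sym e))
decode-injective (suc k) (suc r) c {Fin.suc a} {Fin.zero}  e = ⊥-elim (FinP.punchInᵢ≢i _ _ e)
decode-injective (suc k) (suc r) c {Fin.suc a} {Fin.suc b} e =
  cong Fin.suc (decode-injective k r (tail-code k r c) (FinP.punchIn-injective _ _ _ e))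

decode-separates : ∀ k r c c' → (∀ a → decode k r c a ≡ decode k r c' a) → c ≡ c'
decode-separates k       zero    Fin.zero Fin.zero _ = refl
decode-separates zero    (suc r) c c' _ = ⊥-elim (FinP.¬Fin0 (cast (fall-zero r) c))
decode-separates (suc k) (suc r) c c' same = cast-injective (fall-suc k r) (begin
  cast (fall-suc k r) c               ≡⟨ sym (combine-code k r c) ⟩
  combine (head-code k r c) (tail-code k r c)   ≡⟨ cong₂ combine heads tails ⟩
  combine (head-code k r c') (tail-code k r c') ≡⟨ combine-code k r c' ⟩
  cast (fall-suc k r) c'              ∎)
  where
  open ≡-Reasoning
  heads : head-code k r c ≡ head-code k r c'
  heads = same Fin.zero
  tails : tail-code k r c ≡ tail-code k r c'
  tails = decode-separates k r _ _ λ a → FinP.punchIn-injective (head-code k r c) _ _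
    (trans (same (Fin.suc a)) (cong (λ z → punchIn z (decode k r (tail-code k r c') a)) (sym heads)))

-- A decomposition of P into disjoint chains ("components"), each listed by
-- height: x ≼ y iff x and y lie in the same component and x is not higher.
-- `point i h` is the point at height h of chain i; its bound is irrelevant,
-- so the point does not depend on which proof of the bound is supplied.
record ChainDecomposition (P : FinPoset) : Set₁ where
  field
    Component       : Set
    _≟_             : DecidableEquality Component
    length          : Component → ℕ
    length-pos      : ∀ i → 0 < length i
    component       : Carrier P → Component
    height          : Carrier P → ℕ
    height<length   : ∀ x → height x < length (component x)
    point           : (i : Component) (h : ℕ) → .(h < length i) → Carrier P
    component-point : ∀ i h .p → component (point i h p) ≡ i
    height-point    : ∀ i h .p → height (point i h p) ≡ h
    ≼⇒              : ∀ {x y} → _≼_ P x y →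
                      component x ≡ component y × height x ≤ height y
    ⇒≼              : ∀ {x y} → component x ≡ component y → height x ≤ height y →
                      _≼_ P x y

chain-decomposition : ∀ r → 0 < r → ChainDecomposition (chain r)
chain-decomposition r r>0 = record
  { Component = ⊤ ; _≟_ = λ _ _ → yes refl ; length = λ _ → r ; length-pos = λ _ → r>0
  ; component = λ _ → tt ; height = toℕ ; height<length = FinP.toℕ<n
  ; point = λ _ h p → fromℕ< p
  ; component-point = λ _ _ _ → refl ; height-point = λ _ _ p → FinP.toℕ-fromℕ< p
  ; ≼⇒ = λ x≤y → refl , x≤y ; ⇒≼ = λ _ x≤y → x≤y }

empty-decomposition : ChainDecomposition ∅P
empty-decomposition = record
  { Component = ⊥ ; _≟_ = λ () ; length = λ () ; length-pos = λ ()
  ; component = λ () ; height = λ () ; height<length = λ () ; point = λ ()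
  ; component-point = λ () ; height-point = λ ()
  ; ≼⇒ = λ {x} → ⊥-elim x ; ⇒≼ = λ {x} → ⊥-elim x }

module _ {P Q : FinPoset} (A : ChainDecomposition P) (B : ChainDecomposition Q) where
  private
    module A = ChainDecomposition A
    module B = ChainDecomposition B

    Component : Set
    Component = A.Component ⊎ B.Component

    length : Component → ℕ
    length (inj₁ i) = A.length i
    length (inj₂ i) = B.length i

    component : Carrier P ⊎ Carrier Q → Component
    component (inj₁ x) = inj₁ (A.component x)
    component (inj₂ x) = inj₂ (B.component x)

    height : Carrier P ⊎ Carrier Q → ℕ
    height (inj₁ x) = A.height x
    height (inj₂ x) = B.height x

    point : (i : Component) (h : ℕ) → .(h < length i) → Carrier P ⊎ Carrier Q
    point (inj₁ i) h p = inj₁ (A.point i h p)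
    point (inj₂ i) h p = inj₂ (B.point i h p)

    ≼⇒ : ∀ {x y} → SumLe P Q x y → component x ≡ component y × height x ≤ height y
    ≼⇒ (₁≼₁ x≼y) = cong inj₁ (proj₁ (A.≼⇒ x≼y)) , proj₂ (A.≼⇒ x≼y)
    ≼⇒ (₂≼₂ x≼y) = cong inj₂ (proj₁ (B.≼⇒ x≼y)) , proj₂ (B.≼⇒ x≼y)

    ⇒≼ : ∀ {x y} → component x ≡ component y → height x ≤ height y → SumLe P Q x y
    ⇒≼ {inj₁ x} {inj₁ y} e h≤ = ₁≼₁ (A.⇒≼ (SumP.inj₁-injective e) h≤)
    ⇒≼ {inj₂ x} {inj₂ y} e h≤ = ₂≼₂ (B.⇒≼ (SumP.inj₂-injective e) h≤)
    ⇒≼ {inj₁ x} {inj₂ y} ()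
    ⇒≼ {inj₂ x} {inj₁ y} ()

  sum-decomposition : ChainDecomposition (P ⊕ Q)
  sum-decomposition = record
    { Component = Component ; _≟_ = SumP.≡-dec A._≟_ B._≟_ ; length = length
    ; length-pos = λ { (inj₁ i) → A.length-pos i ; (inj₂ i) → B.length-pos i }
    ; component = component ; height = height
    ; height<length = λ { (inj₁ x) → A.height<length x ; (inj₂ x) → B.height<length x }
    ; point = point
    ; component-point = λ { (inj₁ i) h p → cong inj₁ (A.component-point i h p)
                          ; (inj₂ i) h p → cong inj₂ (B.component-point i h p) }
    ; height-point = λ { (inj₁ i) → A.height-point i ; (inj₂ i) → B.height-point i }
    ; ≼⇒ = ≼⇒ ; ⇒≼ = ⇒≼ }

⨁-decomposition : ∀ m (Ps : Fin m → FinPoset) → (∀ i → ChainDecomposition (Ps i)) →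
                  ChainDecomposition (⨁ m Ps)
⨁-decomposition zero    Ps D = empty-decomposition
⨁-decomposition (suc m) Ps D =
  sum-decomposition (D Fin.zero) (⨁-decomposition m (Ps ∘ Fin.suc) (D ∘ Fin.suc))

segment-injection⇒≤ : ∀ {a b} (g : (k : ℕ) → k < a → ℕ) → (∀ k p → g k p < b) →
                      (∀ k k' p p' → g k p ≡ g k' p' → k ≡ k') → a ≤ b
segment-injection⇒≤ {a} {b} g g<b g-inj = FinP.injective⇒≤ {f = G} G-injective
  where
  G : Fin a → Fin b
  G k = fromℕ< (g<b (toℕ k) (FinP.toℕ<n k))
  G-injective : Injective _≡_ _≡_ G
  G-injective {k} {k'} e = FinP.toℕ-injective (g-inj _ _ _ _ (begin
    g (toℕ k) _  ≡⟨ sym (FinP.toℕ-fromℕ< _) ⟩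
    toℕ (G k)    ≡⟨ cong toℕ e ⟩
    toℕ (G k')   ≡⟨ FinP.toℕ-fromℕ< _ ⟩
    g (toℕ k') _ ∎))
    where open ≡-Reasoning

module Transposition {A : Set} (_≟_ : DecidableEquality A) (a b : A) where

  swap : A → A
  swap x with x ≟ a | x ≟ b
  ... | yes _ | _     = b
  ... | no _  | yes _ = a
  ... | no _  | no _  = x

  swap-a : swap a ≡ b
  swap-a with a ≟ a
  ... | yes _  = refl
  ... | no a≢a = ⊥-elim (a≢a refl)

  swap-b : swap b ≡ a
  swap-b with b ≟ a | b ≟ b
  ... | yes b≡a | _      = b≡a
  ... | no _    | yes _  = refl
  ... | no _    | no b≢b = ⊥-elim (b≢b refl)

  swap-other : ∀ x → x ≢ a → x ≢ b → swap x ≡ x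
  swap-other x x≢a x≢b with x ≟ a | x ≟ b
  ... | yes x≡a | _       = ⊥-elim (x≢a x≡a)
  ... | no _    | yes x≡b = ⊥-elim (x≢b x≡b)
  ... | no _    | no _    = refl

  swap-involutive : ∀ x → swap (swap x) ≡ x
  swap-involutive x with x ≟ a | x ≟ b
  ... | yes refl | _        = swap-b
  ... | no _     | yes refl = swap-a
  ... | no x≢a   | no x≢b   = swap-other x x≢a x≢b

  swap-related : (R : A → A → Set) → R a b → R b a → (∀ x → R x x) →
                 ∀ x → R (swap x) x
  swap-related R Rab Rba R-refl x with x ≟ a | x ≟ b
  ... | yes refl | _        = Rba
  ... | no _     | yes refl = Rab
  ... | no _     | no _     = R-refl x

module Decomposition {P : FinPoset} (D : ChainDecomposition P) where
  open ChainDecomposition D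

  point-unique : ∀ {x y} → component x ≡ component y → height x ≡ height y → x ≡ y
  point-unique c≡ h≡ =
    ≼-antisym P (⇒≼ c≡ (ℕP.≤-reflexive h≡))
                (⇒≼ (sym c≡) (ℕP.≤-reflexive (sym h≡)))

  point-of : ∀ {x} i h .p → component x ≡ i → height x ≡ h → point i h p ≡ x
  point-of i h p c≡ h≡ =
    point-unique (trans (component-point i h p) (sym c≡)) (trans (height-point i h p) (sym h≡))

  point-cong : ∀ {i j h h'} .p .q → i ≡ j → h ≡ h' → point i h p ≡ point j h' q
  point-cong {i} {h = h} p q refl h≡ =
    sym (point-of _ _ q (component-point i h p) (trans (height-point i h p) h≡))

  same-component⇒comparable : ∀ {x y} → component x ≡ component y → Comparable P x y
  same-component⇒comparable {x} {y} c≡ with ℕP.≤-total (height x) (height y)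
  ... | inj₁ x≤y = inj₁ (⇒≼ c≡ x≤y)
  ... | inj₂ y≤x = inj₂ (⇒≼ (sym c≡) y≤x)

  comparable⇒same-component : ∀ {x y} → Comparable P x y → component x ≡ component y
  comparable⇒same-component (inj₁ x≼y) = proj₁ (≼⇒ x≼y)
  comparable⇒same-component (inj₂ y≼x) = sym (proj₁ (≼⇒ y≼x))

  ChainInjective : ∀ {k} → Coloring P k → Set
  ChainInjective c = ∀ i h h' (p : h < length i) (p' : h' < length i) →
                     c (point i h p) ≡ c (point i h' p') → h ≡ h'

  SameColours : ∀ {k} → Coloring P k → Component → Component → Set
  SameColours c i j = length i ≡ length j ×
    (∀ h (p : h < length i) (q : h < length j) → c (point i h p) ≡ c (point j h q))

  same-colours-refl : ∀ {k} {c : Coloring P k} i → SameColours c i i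
  same-colours-refl i = refl , λ h p q → refl

  same-colours-sym : ∀ {k} {c : Coloring P k} {i j} → SameColours c i j → SameColours c j i
  same-colours-sym (l , same) = sym l , λ h p q → sym (same h q p)

  ChainsDistinguished : ∀ {k} → Coloring P k → Set
  ChainsDistinguished c = ∀ i j → SameColours c i j → i ≡ j

  proper⇒chain-injective : ∀ {k} (c : Coloring P k) → Proper P c → ChainInjective c
  proper⇒chain-injective c proper i h h' p p' same with h ℕ.≟ h'
  ... | yes h≡h' = h≡h'
  ... | no h≢h' = ⊥-elim (proper (point i h p) (point i h' p')
          (same-component⇒comparable (trans (component-point i h p) (sym (component-point i h' p'))))
          (λ x≡y → h≢h' (trans (sym (height-point i h p))
                                (trans (cong height x≡y) (height-point i h' p'))))
          same)

  chain-injective⇒proper : ∀ {k} (c : Coloring P k) → ChainInjective c → Proper P c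
  chain-injective⇒proper c injective x y comparable x≢y same = x≢y (point-unique c≡ h≡)
    where
    c≡ : component x ≡ component y
    c≡ = comparable⇒same-component comparable
    y<length : height y < length (component x)
    y<length = subst (λ i → height y < length i) (sym c≡) (height<length y)
    h≡ : height x ≡ height y
    h≡ = injective (component x) (height x) (height y) (height<length x) y<length
      (trans (cong c (point-of _ _ _ refl refl))
             (trans same (cong c (sym (point-of _ _ _ (sym c≡) refl)))))

  module _ (f : Automorphism P) where
    monotone : ∀ {x y} → _≼_ P x y → _≼_ P (fun f x) (fun f y)
    monotone {x} {y} = Equivalence.to (order f x y)

    reflecting : ∀ {x y} → _≼_ P (fun f x) (fun f y) → _≼_ P x y
    reflecting {x} {y} = Equivalence.from (order f x y)

    inverse : Automorphism P
    inverse = record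
      { fun = inv f ; inv = fun f ; fun-inv = inv-fun f ; inv-fun = fun-inv f
      ; order = λ x y → mk⇔
          (λ x≼y → reflecting (subst₂ (_≼_ P) (sym (fun-inv f x)) (sym (fun-inv f y)) x≼y))
          (λ ≼ → subst₂ (_≼_ P) (fun-inv f x) (fun-inv f y) (monotone ≼)) }

    maps-components : ∀ {x y} → component x ≡ component y →
                      component (fun f x) ≡ component (fun f y)
    maps-components c≡ with same-component⇒comparable c≡
    ... | inj₁ x≼y = proj₁ (≼⇒ (monotone x≼y))
    ... | inj₂ y≼x = sym (proj₁ (≼⇒ (monotone y≼x)))

  -- Counting argument: f⁻¹ maps the chain j injectively into one chain, so
  -- f cannot increase chain lengths, nor heights.
  module _ (f : Automorphism P) where
    pulled-height : ∀ j h → h < length j → ℕ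
    pulled-height j h p = height (inv f (point j h p))

    pulled-height-injective : ∀ j h h' p p' →
                              pulled-height j h p ≡ pulled-height j h' p' → h ≡ h'
    pulled-height-injective j h h' p p' e =
      trans (sym (height-point j h p)) (trans (cong height points≡) (height-point j h' p'))
      where
      preimages≡ : inv f (point j h p) ≡ inv f (point j h' p')
      preimages≡ = point-unique
        (maps-components (inverse f) (trans (component-point j h p) (sym (component-point j h' p')))) e
      points≡ : point j h p ≡ point j h' p'
      points≡ = trans (sym (fun-inv f _)) (trans (cong (fun f) preimages≡) (fun-inv f _))

    pulled-component : ∀ x h p → component (inv f (point (component (fun f x)) h p)) ≡ component x
    pulled-component x h p =
      trans (maps-components (inverse f) (component-point _ h p)) (cong component (inv-fun f x))

    length-nonincreasing : ∀ x → length (component (fun f x)) ≤ length (component x)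
    length-nonincreasing x = segment-injection⇒≤ (pulled-height j) below (pulled-height-injective j)
      where
      j : Component
      j = component (fun f x)
      below : ∀ h p → pulled-height j h p < length (component x)
      below h p =
        subst (λ i → pulled-height j h p < length i) (pulled-component x h p) (height<length _)

    pulled-below : ∀ x {y} → component y ≡ component (fun f x) → height y < height (fun f x) →
                   height (inv f y) < height x
    pulled-below x {y} c≡ y<fx = ℕP.≤∧≢⇒< (proj₂ (≼⇒ pulled≼x)) pulled≢x
      where
      pulled≼x : _≼_ P (inv f y) x
      pulled≼x = reflecting f
        (subst (λ z → _≼_ P z (fun f x)) (sym (fun-inv f y)) (⇒≼ c≡ (ℕP.<⇒≤ y<fx)))
      pulled≢x : height (inv f y) ≢ height x
      pulled≢x e = ℕP.<-irrefl (cong height y≡fx) y<fx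
        where
        y≡fx : y ≡ fun f x
        y≡fx = trans (sym (fun-inv f y)) (cong (fun f) (point-unique (proj₁ (≼⇒ pulled≼x)) e))

    height-nonincreasing : ∀ x → height (fun f x) ≤ height x
    height-nonincreasing x =
      segment-injection⇒≤ (λ h p → pulled-height j h (in-chain p)) below
                           (λ h h' p p' → pulled-height-injective j h h' (in-chain p) (in-chain p'))
      where
      j : Component
      j = component (fun f x)
      in-chain : ∀ {h} → h < height (fun f x) → h < length j
      in-chain h< = ℕP.<-trans h< (height<length (fun f x))
      below : ∀ h p → pulled-height j h (in-chain p) < height x
      below h p = pulled-below x (component-point j h _)
                               (subst (_< height (fun f x)) (sym (height-point j h (in-chain p))) p)

  -- Applying the counting bounds to f and f⁻¹ gives equality.
  preserves-height : (f : Automorphism P) → ∀ x → height (fun f x) ≡ height x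
  preserves-height f x = ℕP.≤-antisym (height-nonincreasing f x)
    (subst (λ z → height z ≤ height (fun f x)) (inv-fun f x)
           (height-nonincreasing (inverse f) (fun f x)))

  preserves-length : (f : Automorphism P) →
                     ∀ x → length (component (fun f x)) ≡ length (component x)
  preserves-length f x = ℕP.≤-antisym (length-nonincreasing f x)
    (subst (λ z → length (component z) ≤ length (component (fun f x))) (inv-fun f x)
           (length-nonincreasing (inverse f) (fun f x)))

  -- A colour-preserving automorphism maps the chain of x to a chain of the
  -- same length and the same colour sequence, hence to itself.
  chains-distinguished⇒distinguishing : ∀ {k} (c : Coloring P k) →
                                        ChainsDistinguished c → Distinguishing P c
  chains-distinguished⇒distinguishing c distinguished f preserves x =
    point-unique (sym i≡j) (preserves-height f x)
    where
    i j : Component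
    i = component x
    j = component (fun f x)
    same-colours : ∀ h p q → c (point i h p) ≡ c (point j h q)
    same-colours h p q = trans (sym (preserves y)) (cong c (sym (point-of j h q
      (maps-components f (component-point i h p)) (trans (preserves-height f y) (height-point i h p)))))
      where
      y : Carrier P
      y = point i h p
    i≡j : i ≡ j
    i≡j = distinguished i j (sym (preserves-length f x) , same-colours)

  module Relabel (τ : Component → Component) (τ-involutive : ∀ i → τ (τ i) ≡ i)
                 (τ-length : ∀ i → length (τ i) ≡ length i) where

    relabel : Carrier P → Carrier P
    relabel x = point (τ (component x)) (height x)
                      (subst (height x <_) (sym (τ-length (component x))) (height<length x))

    relabel-component : ∀ x → component (relabel x) ≡ τ (component x)
    relabel-component x = component-point _ _ _

    relabel-height : ∀ x → height (relabel x) ≡ height x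
    relabel-height x = height-point _ _ _

    relabel-involutive : ∀ x → relabel (relabel x) ≡ x
    relabel-involutive x = point-unique
      (trans (relabel-component _) (trans (cong τ (relabel-component x)) (τ-involutive _)))
      (trans (relabel-height _) (relabel-height x))

    relabel-monotone : ∀ {x y} → _≼_ P x y → _≼_ P (relabel x) (relabel y)
    relabel-monotone {x} {y} x≼y = ⇒≼
      (trans (relabel-component x)
             (trans (cong τ (proj₁ (≼⇒ x≼y))) (sym (relabel-component y))))
      (subst₂ _≤_ (sym (relabel-height x)) (sym (relabel-height y)) (proj₂ (≼⇒ x≼y)))

    relabel-automorphism : Automorphism P
    relabel-automorphism = record
      { fun = relabel ; inv = relabel ; fun-inv = relabel-involutive ; inv-fun = relabel-involutive
      ; order = λ x y → mk⇔ relabel-monotone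
          (λ ≼ → subst₂ (_≼_ P) (relabel-involutive x) (relabel-involutive y)
                        (relabel-monotone ≼)) }

  -- Two distinct chains of equal length with equal colour sequences could be
  -- swapped by a colour-preserving automorphism.
  distinguishing⇒chains-distinguished : ∀ {k} (c : Coloring P k) →
                                        Distinguishing P c → ChainsDistinguished c
  distinguishing⇒chains-distinguished c distinguishing a b a~b = begin
    a                         ≡⟨ sym (component-point a 0 (length-pos a)) ⟩
    component y               ≡⟨ cong component (sym fixed) ⟩
    component (relabel y)     ≡⟨ relabel-component y ⟩
    swap (component y)        ≡⟨ cong swap (component-point a 0 (length-pos a)) ⟩
    swap a                    ≡⟨ swap-a ⟩
    b                         ∎
    where
    open ≡-Reasoning
    open Transposition _≟_ a b
    swap-same : ∀ i → SameColours c (swap i) i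
    swap-same =
      swap-related (SameColours c) a~b (same-colours-sym {c = c} a~b) (same-colours-refl {c = c})
    open Relabel swap swap-involutive (proj₁ ∘ swap-same)
    preserves : ∀ x → c (relabel x) ≡ c x
    preserves x = trans (proj₂ (swap-same i) (height x) h<swapped (height<length x))
                        (cong c (point-of _ _ _ refl refl))
      where
      i : Component
      i = component x
      h<swapped : height x < length (swap i)
      h<swapped = subst (height x <_) (sym (proj₁ (swap-same i))) (height<length x)
    y : Carrier P
    y = point a 0 (length-pos a)
    fixed : relabel y ≡ y
    fixed = distinguishing relabel-automorphism preserves y

  ChainColouring : ℕ → Set
  ChainColouring k = Σ[ c ∈ Coloring P k ] (ChainInjective c × ChainsDistinguished c)

  from-proper-distinguishing : ∀ {k} → ProperDistinguishing P k → ChainColouring k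
  from-proper-distinguishing (c , proper , distinguishing) =
    c , proper⇒chain-injective c proper , distinguishing⇒chains-distinguished c distinguishing

  to-proper-distinguishing : ∀ {k} → ChainColouring k → ProperDistinguishing P k
  to-proper-distinguishing (c , injective , distinguished) =
    c , chain-injective⇒proper c injective , chains-distinguished⇒distinguishing c distinguished

  ColourSequences : ℕ → Set
  ColourSequences k = (i : Component) (h : ℕ) → .(h < length i) → Fin k

  sequence-colouring : ∀ {k} → ColourSequences k → Coloring P k
  sequence-colouring s x = s (component x) (height x) (height<length x)

  sequence-colouring-point : ∀ {k} (s : ColourSequences k) i h p →
                             sequence-colouring s (point i h p) ≡ s i h p
  sequence-colouring-point s i h p = at (point i h p) (component-point i h p) (height-point i h p)
    where
    at : ∀ y {i h} .{p : h < length i} → component y ≡ i → height y ≡ h →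
         sequence-colouring s y ≡ s i h p
    at y refl refl = refl

  enlarge-palette : ∀ {k K} → k ≤ K → ProperDistinguishing P k → ProperDistinguishing P K
  enlarge-palette k≤K pd with from-proper-distinguishing pd
  ... | c , injective , distinguished = to-proper-distinguishing
    ( (λ x → inject≤ (c x) k≤K)
    , (λ i h h' p p' e → injective i h h' p p' (include-injective e))
    , (λ { i j (l , same) → distinguished i j (l , λ h p q → include-injective (same h p q)) }))
    where
    include-injective : ∀ {a b} → inject≤ a k≤K ≡ inject≤ b k≤K → a ≡ b
    include-injective = FinP.inject≤-injective k≤K k≤K _ _

  -- If all chains have r points and there are at most t ≤ (k)_r of them,
  -- colouring the chains by distinct injections Fin r → Fin k is proper and
  -- distinguishing.
  uniform-colouring : ∀ {t r k} → (∀ i → length i ≡ r) → Component ↣ Fin t →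
                      t ≤ fall k r → ProperDistinguishing P k
  uniform-colouring {t} {r} {k} length≡r index t≤ =
    to-proper-distinguishing (c , injective , distinguished)
    where
    code : Component → Fin (fall k r)
    code i = inject≤ (Injection.to index i) t≤
    at : ∀ i h → .(h < length i) → Fin r
    at i h p = fromℕ< (subst (h <_) (length≡r i) p)
    colours : ColourSequences k
    colours i h p = decode k r (code i) (at i h p)
    c : Coloring P k
    c = sequence-colouring colours
    colour-point : ∀ i h p → c (point i h p) ≡ decode k r (code i) (at i h p)
    colour-point = sequence-colouring-point colours
    injective : ChainInjective c
    injective i h h' p p' same = FinP.fromℕ<-injective h h' _ _ (decode-injective k r (code i)
      (trans (sym (colour-point i h p)) (trans same (colour-point i h' p'))))
    distinguished : ChainsDistinguished c
    distinguished i j (_ , same) = Injection.injective index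
      (FinP.inject≤-injective t≤ t≤ _ _ (decode-separates k r _ _ same-sequence))
      where
      below : ∀ i (a : Fin r) → toℕ a < length i
      below i a = subst (toℕ a <_) (sym (length≡r i)) (FinP.toℕ<n a)
      same-sequence : ∀ a → decode k r (code i) a ≡ decode k r (code j) a
      same-sequence a = begin
        decode k r (code i) a
          ≡⟨ cong (decode k r (code i)) (sym (FinP.fromℕ<-toℕ a _)) ⟩
        decode k r (code i) (at i (toℕ a) (below i a))
          ≡⟨ sym (colour-point i _ (below i a)) ⟩
        c (point i (toℕ a) (below i a))
          ≡⟨ same (toℕ a) (below i a) (below j a) ⟩
        c (point j (toℕ a) (below j a))
          ≡⟨ colour-point j _ (below j a) ⟩
        decode k r (code j) (at j (toℕ a) (below j a))
          ≡⟨ cong (decode k r (code j)) (FinP.fromℕ<-toℕ a _) ⟩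
        decode k r (code j) a
          ∎
        where open ≡-Reasoning

  -- If P has t distinct chains of r points, a proper distinguishing
  -- k-colouring colours them by t distinct injections Fin r → Fin k.
  uniform-lower-bound : ∀ {t r k} (label : Fin t ↣ Component) →
                        (∀ a → length (Injection.to label a) ≡ r) →
                        ProperDistinguishing P k → t ≤ fall k r
  uniform-lower-bound {t} {r} {k} label length≡r pd with from-proper-distinguishing pd
  ... | c , injective , distinguished = FinP.injective⇒≤ {f = code} code-injective
    where
    open Injection label using () renaming (to to chain-of; injective to chain-of-injective)
    below : ∀ a (h : Fin r) → toℕ h < length (chain-of a)
    below a h = subst (toℕ h <_) (sym (length≡r a)) (FinP.toℕ<n h)
    colours : Fin t → Fin r → Fin k
    colours a h = c (point (chain-of a) (toℕ h) (below a h))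
    colours-injective : ∀ a → Injective _≡_ _≡_ (colours a)
    colours-injective a {h} {h'} e =
      FinP.toℕ-injective (injective (chain-of a) _ _ (below a h) (below a h') e)
    code : Fin t → Fin (fall k r)
    code a = encode k r (colours a) (colours-injective a)
    code-injective : Injective _≡_ _≡_ code
    code-injective {a} {a'} e =
      chain-of-injective (distinguished (chain-of a) (chain-of a') (length≡ , same))
      where
      length≡ : length (chain-of a) ≡ length (chain-of a')
      length≡ = trans (length≡r a) (sym (length≡r a'))
      same-colours : ∀ h → colours a h ≡ colours a' h
      same-colours =
        encode-injective k r (colours a) (colours a') (colours-injective a) (colours-injective a') e
      same : ∀ h p q → c (point (chain-of a) h p) ≡ c (point (chain-of a') h q)
      same h p q = begin
        c (point (chain-of a) h p)  ≡⟨ cong c (point-cong p _ refl (sym (FinP.toℕ-fromℕ< h<r))) ⟩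
        colours a (fromℕ< h<r)      ≡⟨ same-colours (fromℕ< h<r) ⟩
        colours a' (fromℕ< h<r)     ≡⟨ cong c (point-cong _ q refl (FinP.toℕ-fromℕ< h<r)) ⟩
        c (point (chain-of a') h q) ∎
        where
        open ≡-Reasoning
        h<r : h < r
        h<r = subst (h <_) (length≡r a) p

module _ {P Q : FinPoset} (A : ChainDecomposition P) (B : ChainDecomposition Q) where
  private
    module A = Decomposition A
    module B = Decomposition B
    module A+B = Decomposition (sum-decomposition A B)
    open ChainDecomposition using (length)

  -- When no chain of P is as long as a chain of Q, no automorphism can mix
  -- the summands, so proper distinguishing colourings of P and Q combine.
  sum-colouring : ∀ {k} → (∀ i j → length A i ≢ length B j) →
                  ProperDistinguishing P k → ProperDistinguishing Q k →
                  ProperDistinguishing (P ⊕ Q) k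
  sum-colouring {k} lengths-differ pdA pdB
    with A.from-proper-distinguishing pdA | B.from-proper-distinguishing pdB
  ... | cA , injA , distA | cB , injB , distB =
    A+B.to-proper-distinguishing (c , injective , distinguished)
    where
    c : Coloring (P ⊕ Q) k
    c (inj₁ x) = cA x
    c (inj₂ x) = cB x
    injective : A+B.ChainInjective c
    injective (inj₁ i) = injA i
    injective (inj₂ i) = injB i
    distinguished : A+B.ChainsDistinguished c
    distinguished (inj₁ i) (inj₁ j) same       = cong inj₁ (distA i j same)
    distinguished (inj₂ i) (inj₂ j) same       = cong inj₂ (distB i j same)
    distinguished (inj₁ i) (inj₂ j) (l , _) = ⊥-elim (lengths-differ i j l)
    distinguished (inj₂ i) (inj₁ j) (l , _) = ⊥-elim (lengths-differ j i (sym l))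

  restrict-sum : ∀ {k} → ProperDistinguishing (P ⊕ Q) k →
                 ProperDistinguishing P k × ProperDistinguishing Q k
  restrict-sum pd with A+B.from-proper-distinguishing pd
  ... | c , injective , distinguished =
      A.to-proper-distinguishing (c ∘ inj₁ , injective ∘ inj₁ ,
        λ i j same → SumP.inj₁-injective (distinguished (inj₁ i) (inj₁ j) same))
    , B.to-proper-distinguishing (c ∘ inj₂ , injective ∘ inj₂ ,
        λ i j same → SumP.inj₂-injective (distinguished (inj₂ i) (inj₂ j) same))

module _ where
  open ChainDecomposition using (Component; length)

  LengthSeparated : ∀ {m} {Ps : Fin m → FinPoset} → (∀ b → ChainDecomposition (Ps b)) → Set
  LengthSeparated D = ∀ b b' i i' → length (D b) i ≡ length (D b') i' → b ≡ b'

  ⨁-summand : ∀ {m} {Ps : Fin m → FinPoset} (D : ∀ b → ChainDecomposition (Ps b))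
              (i : Component (⨁-decomposition m Ps D)) →
              Σ[ b ∈ Fin m ] Σ[ i' ∈ Component (D b) ]
                length (⨁-decomposition m Ps D) i ≡ length (D b) i'
  ⨁-summand {m = suc m} D (inj₁ i) = Fin.zero , i , refl
  ⨁-summand {m = suc m} D (inj₂ i) with ⨁-summand (D ∘ Fin.suc) i
  ... | b , i' , e = Fin.suc b , i' , e

⨁-colouring : ∀ m (Ps : Fin m → FinPoset) (D : ∀ b → ChainDecomposition (Ps b)) →
              LengthSeparated D →
              ∀ {k} → (∀ b → ProperDistinguishing (Ps b) k) → ProperDistinguishing (⨁ m Ps) k
⨁-colouring zero    Ps D separated pds = (λ ()) , (λ ()) , (λ _ _ ())
⨁-colouring (suc m) Ps D separated pds =
  sum-colouring (D Fin.zero) (⨁-decomposition m (Ps ∘ Fin.suc) (D ∘ Fin.suc)) lengths-differ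
    (pds Fin.zero)
    (⨁-colouring m (Ps ∘ Fin.suc) (D ∘ Fin.suc) separated-tail (pds ∘ Fin.suc))
  where
  open ChainDecomposition using (length)
  separated-tail : LengthSeparated (D ∘ Fin.suc)
  separated-tail b b' i i' e = FinP.suc-injective (separated (Fin.suc b) (Fin.suc b') i i' e)
  lengths-differ : ∀ i j →
                   length (D Fin.zero) i ≢ length (⨁-decomposition m (Ps ∘ Fin.suc) (D ∘ Fin.suc)) j
  lengths-differ i j e with ⨁-summand (D ∘ Fin.suc) j
  ... | b , j' , e' with separated Fin.zero (Fin.suc b) i j' (trans e e')
  ... | ()

⨁-restrict : ∀ m (Ps : Fin m → FinPoset) (D : ∀ b → ChainDecomposition (Ps b)) →
             ∀ {k} → ProperDistinguishing (⨁ m Ps) k → ∀ b → ProperDistinguishing (Ps b) k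
⨁-restrict (suc m) Ps D pd Fin.zero    =
  proj₁ (restrict-sum (D Fin.zero) (⨁-decomposition m (Ps ∘ Fin.suc) (D ∘ Fin.suc)) pd)
⨁-restrict (suc m) Ps D pd (Fin.suc b) = ⨁-restrict m (Ps ∘ Fin.suc) (D ∘ Fin.suc)
  (proj₂ (restrict-sum (D Fin.zero) (⨁-decomposition m (Ps ∘ Fin.suc) (D ∘ Fin.suc)) pd)) b

chains-decomposition : ∀ t r → 0 < r → ChainDecomposition (chains t r)
chains-decomposition t r r>0 =
  ⨁-decomposition t (λ _ → chain r) (λ _ → chain-decomposition r r>0)

module _ (r : ℕ) (r>0 : 0 < r) where
  open ChainDecomposition

  chains-length : ∀ t i → length (chains-decomposition t r r>0) i ≡ r
  chains-length t i = proj₂ (proj₂ (⨁-summand {m = t} (λ _ → chain-decomposition r r>0) i))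

  chains-components : ∀ t → Component (chains-decomposition t r r>0) ↔ Fin t
  chains-components t = mk↔ₛ′ (index t) (label t) (index-label t) (label-index t)
    where
    index : ∀ t → Component (chains-decomposition t r r>0) → Fin t
    index (suc t) (inj₁ _) = Fin.zero
    index (suc t) (inj₂ i) = Fin.suc (index t i)
    label : ∀ t → Fin t → Component (chains-decomposition t r r>0)
    label (suc t) Fin.zero    = inj₁ tt
    label (suc t) (Fin.suc a) = inj₂ (label t a)
    index-label : ∀ t a → index t (label t a) ≡ a
    index-label (suc t) Fin.zero    = refl
    index-label (suc t) (Fin.suc a) = cong Fin.suc (index-label t a)
    label-index : ∀ t i → label t (index t i) ≡ i
    label-index (suc t) (inj₁ _) = refl
    label-index (suc t) (inj₂ i) = cong inj₂ (label-index t i)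

fall-threshold : ∀ {k t j} r → fall (k ∸ 1) r < t → t ≤ fall j r → k ≤ j
fall-threshold {k} {t} {j} r below above = ℕP.≮⇒≥ λ j<k →
  ℕP.<-irrefl refl
    (ℕP.≤-<-trans (ℕP.≤-trans above (fall-monoˡ r (ℕP.∸-monoˡ-≤ 1 j<k))) below)

maxF-lub : ∀ m (f : Fin m → ℕ) {j} → (∀ b → f b ≤ j) → maxF m f ≤ j
maxF-lub zero    f bound = z≤n
maxF-lub (suc m) f bound = ℕP.⊔-lub (bound Fin.zero) (maxF-lub m (f ∘ Fin.suc) (bound ∘ Fin.suc))

maxF-upper : ∀ m (f : Fin m → ℕ) b → f b ≤ maxF m f
maxF-upper (suc m) f Fin.zero    = ℕP.m≤m⊔n _ _
maxF-upper (suc m) f (Fin.suc b) = ℕP.≤-trans (maxF-upper m (f ∘ Fin.suc) b) (ℕP.m≤n⊔m _ _)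

proposition4p4 :
    ((r t k : ℕ) → 1 ≤ r → 1 ≤ t → 1 ≤ k →
       fall (k ∸ 1) r < t → t ≤ fall k r →
       χD≡ (chains t r) k)
    ×
    ((m : ℕ) → 1 ≤ m → (rs ts : Fin m → ℕ) →
       (∀ i → 1 ≤ rs i) → (∀ i → 1 ≤ ts i) →
       Injective _≡_ _≡_ rs →
       (χs : Fin m → ℕ) → (∀ i → χD≡ (chains (ts i) (rs i)) (χs i)) →
       χD≡ (⨁ m (λ i → chains (ts i) (rs i))) (maxF m χs))
proposition4p4 = part-i , part-ii
  where
  part-i : (r t k : ℕ) → 1 ≤ r → 1 ≤ t → 1 ≤ k → fall (k ∸ 1) r < t → t ≤ fall k r →
           χD≡ (chains t r) k
  part-i r t k r>0 _ _ below above =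
      uniform-colouring (chains-length r r>0 t) (↔⇒↣ (chains-components r r>0 t)) above
    , λ j pd → fall-threshold r below
        (uniform-lower-bound (↔⇒↣ (↔-sym (chains-components r r>0 t)))
                             (λ _ → chains-length r r>0 t _) pd)
    where open Decomposition (chains-decomposition t r r>0)

  part-ii : (m : ℕ) → 1 ≤ m → (rs ts : Fin m → ℕ) →
            (∀ i → 1 ≤ rs i) → (∀ i → 1 ≤ ts i) → Injective _≡_ _≡_ rs →
            (χs : Fin m → ℕ) → (∀ i → χD≡ (chains (ts i) (rs i)) (χs i)) →
            χD≡ (⨁ m (λ i → chains (ts i) (rs i))) (maxF m χs)
  part-ii m _ rs ts rs>0 _ rs-injective χs χ =
      ⨁-colouring m _ D separated (λ b →
        Decomposition.enlarge-palette (D b) (maxF-upper m χs b) (proj₁ (χ b)))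
    , λ j pd → maxF-lub m χs (λ b → proj₂ (χ b) j (⨁-restrict m _ D pd b))
    where
    D : ∀ b → ChainDecomposition (chains (ts b) (rs b))
    D b = chains-decomposition (ts b) (rs b) (rs>0 b)
    separated : LengthSeparated D
    separated b b' i i' e = rs-injective (begin
      rs b                                 ≡⟨ sym (chains-length (rs b) (rs>0 b) (ts b) i) ⟩
      ChainDecomposition.length (D b) i    ≡⟨ e ⟩
      ChainDecomposition.length (D b') i'  ≡⟨ chains-length (rs b') (rs>0 b') (ts b') i' ⟩
      rs b'                                ∎)
      where open ≡-Reasoning
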